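{- Let $m\geq 2$ be even and $r\geq 1$. All flips along an $r$-rainbow cycle in $G_m^{M}$ are centered flips.
   Context: Let $n=2m$ points be equally spaced on a unit circle centered at the origin, labeled clockwise $1,\dots,n$. $E_m=\{\{i,j\}: i,j\in[n],\ j-i\text{ odd}\}$. The directed graph $G_m^{M}$ has the non-crossing perfect matchings on these points as vertices and an arc $(M,M')$ whenever $M'$ is obtained from $M$ by replacing two edges $\{a,b\},\{c,d\}\in M$ by $\{a,c\},\{b,d\}$ (a flip), labeled by the two entering edges. An $r$-rainbow cycle is a directed cycle (no repeated vertices) along which every element of $E_m$ appears exactly $r$ times among the arc labels. The length $\ell(e)$ of an edge $e=\{i,j\}\in E_m$ is the minimum, over the two sides of $e$, of (number of the $n$ points strictly on that side)$/2$; equivalently, the minimum number of other matching edges on either side in any perfect matching containing $e$. Lengths range over $0,1,\dots,(m-2)/2$. A flip involves a convex quadrilateral whose four sides are the two removed and two added edges; the flip is centered if the sum of the lengths of these four edges equals $m-2$ (equivalently, the quadrilateral contains the origin). -}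

module Defs where

open import Data.Nat using (ℕ; zero; suc; _+_; _*_; _∸_; _<_; _≤_; _⊓_; _/_; _%_; ∣_-_∣; _≡ᵇ_)
open import Data.Fin using (Fin; toℕ)
open import Data.Bool using (Bool; true; false; if_then_else_; _∧_; _∨_)
open import Data.Product using (_×_; _,_)
open import Relation.Binary.PropositionalEquality using (_≡_; _≢_)
open import Relation.Nullary using (¬_)

-- Points are labelled 0,…,n-1 (instead of 1,…,n) in clockwise order.
-- A perfect matching is given by its partner function p : Fin n → Fin n.

Partner : ℕ → Set
Partner n = Fin n → Fin n

record IsNCPM (n : ℕ) (p : Partner n) : Set where
  field
    involutive  : ∀ x → p (p x) ≡ x
    fixpt-free  : ∀ x → p x ≢ x
    noncrossing : ∀ a b c d → toℕ a < toℕ b → toℕ b < toℕ c → toℕ c < toℕ d →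
                  p a ≡ c → p b ≢ d

-- equality of matchings (as sets of edges) = pointwise equality of partner functions
_≈M_ : ∀ {n} → Partner n → Partner n → Set
M ≈M M' = ∀ x → M x ≡ M' x

-- flip data: the arc (M , M') replaces {a,b},{c,d} ∈ M by {a,c},{b,d}
record Quad (n : ℕ) : Set where
  constructor quad
  field
    qa qb qc qd : Fin n
open Quad public

record IsFlip {n : ℕ} (M M' : Partner n) (q : Quad n) : Set where
  field
    ab∈M   : M (qa q) ≡ qb q
    cd∈M   : M (qc q) ≡ qd q
    a≢c    : qa q ≢ qc q
    a≢d    : qa q ≢ qd q
    b≢c    : qb q ≢ qc q
    b≢d    : qb q ≢ qd q
    ac∈M'  : M' (qa q) ≡ qc q
    bd∈M'  : M' (qb q) ≡ qd q
    others : ∀ x → x ≢ qa q → x ≢ qb q → x ≢ qc q → x ≢ qd q → M' x ≡ M x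

-- length of the edge {x,y} among n points:
-- min over the two sides of (number of points strictly on that side)/2
edgeLength : ∀ {n} → Fin n → Fin n → ℕ
edgeLength {n} x y = ((d ∸ 1) ⊓ (n ∸ 1 ∸ d)) / 2
  where d = ∣ toℕ x - toℕ y ∣

Centered : ∀ (m : ℕ) → Quad (2 * m) → Set
Centered m (quad a b c d) =
  edgeLength a b + edgeLength c d + edgeLength a c + edgeLength b d ≡ m ∸ 2

sameEdge : ∀ {n} → ℕ × ℕ → Fin n → Fin n → Bool
sameEdge (i , j) x y = ((toℕ x ≡ᵇ i) ∧ (toℕ y ≡ᵇ j)) ∨ ((toℕ x ≡ᵇ j) ∧ (toℕ y ≡ᵇ i))

ind : Bool → ℕ
ind true  = 1
ind false = 0

labelCount : ∀ {n} → (ℕ → Quad n) → ℕ × ℕ → ℕ → ℕ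
labelCount F e zero = 0
labelCount F e (suc t) =
  labelCount F e t + ind (sameEdge e (qa (F t)) (qc (F t)))
                   + ind (sameEdge e (qb (F t)) (qd (F t)))

-- E_m : pairs i < j < n with j - i odd (as ordered representatives of unordered edges)
InE : ℕ → ℕ × ℕ → Set
InE n (i , j) = (i < j) × (j < n) × ((j ∸ i) % 2 ≡ 1)

-- An r-rainbow cycle in G_m^M of length k ≥ 1: matchings Ms 0, …, Ms (k-1)
-- (Ms k = Ms 0), pairwise distinct, with flips F t : Ms t → Ms (t+1),
-- every edge of E_m appearing exactly r times among the labels.
record RainbowCycle (m r : ℕ) (k : ℕ) (Ms : ℕ → Partner (2 * m)) (F : ℕ → Quad (2 * m)) : Set where
  field
    k≥1       : 1 ≤ k
    vertices  : ∀ t → t < k → IsNCPM (2 * m) (Ms t)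
    closed    : Ms k ≈M Ms 0
    arcs      : ∀ t → t < k → IsFlip (Ms t) (Ms (suc t)) (F t)
    distinct  : ∀ i j → i < j → j < k → ¬ (Ms i ≈M Ms j)
    rainbow   : ∀ e → InE (2 * m) e → labelCount F e k ≡ r

-- A flip replaces the sides ab, cd of the quadrilateral a-b-d-c by its other two sides ac, bd.
-- As neither pair crosses, these are the sides between circularly consecutive corners, and
-- the length of each side is at most half the number of points beyond it.  These four sets of
-- points are disjoint, so the four lengths of any flip sum to at most m − 2.  Around a closed
-- cycle the removed and the added edges have the same total length, because the potential
-- Σₓ ℓ(x, M x) returns to its initial value.  In an r-rainbow cycle the added edges run through
-- E_m exactly r times, and for even m the lengths 4ℓ(e) have the same sum over E_m as the
-- constant m − 2 (pair distance d with 2m − d and, below m, with m − d).  Hence the k flips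
-- have total length k(m − 2), and each of them attains its bound.

module Submission where

open import Defs
open import Data.Nat
open import Data.Nat.Properties
open import Data.Nat.DivMod using (%-distribˡ-+; m/n*n≤m; m≡m%n+[m/n]*n; m*n/n≡m; m*n%n≡0)
open import Data.Nat.Induction using (<-rec)
open import Data.Nat.ListAction using () renaming (sum to sumˡ)
open import Data.Nat.Tactic.RingSolver using (solve-∀)
open import Algebra.Properties.CommutativeMonoid.Sum +-0-commutativeMonoid using (sum; sum-remove; sum-cong-≗)
open import Algebra.Properties.CommutativeSemigroup +-commutativeSemigroup using (xy∙z≈xz∙y; interchange)
open import Algebra.Properties.CommutativeSemigroup *-commutativeSemigroup using (x∙yz≈y∙xz)
open import Data.Bool using (T; true; false; _∧_; _∨_)
open import Data.Bool.Properties using (T-∧; T-∨; ∧-comm; ∨-comm)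
open import Data.Empty using (⊥-elim)
open import Data.Fin using (Fin; toℕ; fromℕ<)
import Data.Fin as Fin
open import Data.Fin.Properties using (toℕ-injective; toℕ<n; toℕ-fromℕ<; punchInᵢ≢i)
open import Data.List using (List; []; _∷_; map)
open import Data.List.Membership.Propositional using (_∉_)
open import Data.List.Relation.Unary.All using (All; []; _∷_)
import Data.List.Relation.Unary.All as All
open import Data.List.Relation.Unary.Any using (here; there)
open import Data.List.Relation.Unary.Unique.Propositional using (Unique; []; _∷_)
open import Data.Product using (_×_; _,_; proj₁; proj₂)
open import Data.Sum using (_⊎_; inj₁; inj₂)
open import Data.Vec.Functional using (updateAt; removeAt)
open import Data.Vec.Functional.Properties using (updateAt-updates; updateAt-minimal)
open import Function using (_∘_; case_of_; Equivalence)
open import Relation.Binary using (Tri; tri<; tri≈; tri>)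
open import Relation.Binary.PropositionalEquality
open import Relation.Nullary using (¬_; yes; no; contradiction)

<∸⇒+< : ∀ i {d n} → d < n ∸ i → i + d < n
<∸⇒+< zero                lt = lt
<∸⇒+< (suc i) {n = suc n} lt = s≤s (<∸⇒+< i lt)

2*m≡m+m : ∀ m → 2 * m ≡ m + m
2*m≡m+m m = cong (m +_) (+-identityʳ m)

double-injective : ∀ a b → a + a ≡ b + b → a ≡ b
double-injective a b eq = *-cancelˡ-≡ a b 2 (begin
  a + (a + 0) ≡⟨ cong (a +_) (+-identityʳ a) ⟩
  a + a       ≡⟨ eq ⟩
  b + b       ≡⟨ cong (b +_) (+-identityʳ b) ⟨
  b + (b + 0) ∎)
  where open ≡-Reasoning

%2-cases : ∀ d → d % 2 ≡ 0 ⊎ d % 2 ≡ 1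
%2-cases 0             = inj₁ refl
%2-cases 1             = inj₂ refl
%2-cases (suc (suc d)) = %2-cases d

odd⇒0< : ∀ d → d % 2 ≡ 1 → 0 < d
odd⇒0< (suc _) _ = z<s

odd-split : ∀ d → d % 2 ≡ 1 → d ≡ suc (d / 2 * 2)
odd-split d odd = trans (m≡m%n+[m/n]*n d 2) (cong (_+ d / 2 * 2) odd)

even-sum⇒same-parity : ∀ a b → (a + b) % 2 ≡ 0 → a % 2 ≡ b % 2
even-sum⇒same-parity a b a+b-even
  with a % 2 | b % 2 | %2-cases a | %2-cases b | trans (sym (%-distribˡ-+ a b 2)) a+b-even
... | _ | _ | inj₁ refl | inj₁ refl | _  = refl
... | _ | _ | inj₂ refl | inj₂ refl | _  = refl
... | _ | _ | inj₁ refl | inj₂ refl | ()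
... | _ | _ | inj₂ refl | inj₁ refl | ()

%2-complement : ∀ {n} d → n % 2 ≡ 0 → d ≤ n → (n ∸ d) % 2 ≡ d % 2
%2-complement {n} d n-even d≤n = even-sum⇒same-parity (n ∸ d) d (subst (λ k → k % 2 ≡ 0) (sym (m∸n+n≡m d≤n)) n-even)

sum< : ℕ → (ℕ → ℕ) → ℕ
sum< zero    f = 0
sum< (suc k) f = sum< k f + f k

syntax sum< k (λ i → e) = ∑[ i < k ] e

module _ {f g : ℕ → ℕ} where

  ∑-cong : ∀ k → (∀ i → i < k → f i ≡ g i) → sum< k f ≡ sum< k g
  ∑-cong zero    eq = refl
  ∑-cong (suc k) eq = cong₂ _+_ (∑-cong k λ i i<k → eq i (m<n⇒m<1+n i<k)) (eq k ≤-refl)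

  ∑-+ : ∀ k → ∑[ i < k ] (f i + g i) ≡ sum< k f + sum< k g
  ∑-+ zero    = refl
  ∑-+ (suc k) = trans (cong (_+ (f k + g k)) (∑-+ k)) (interchange (sum< k f) _ _ _)

∑-zero : ∀ {f} k → (∀ i → i < k → f i ≡ 0) → sum< k f ≡ 0
∑-zero zero    eq = refl
∑-zero (suc k) eq = cong₂ _+_ (∑-zero k λ i i<k → eq i (m<n⇒m<1+n i<k)) (eq k ≤-refl)

∑-*ˡ : ∀ c f k → ∑[ i < k ] (c * f i) ≡ c * sum< k f
∑-*ˡ c f zero    = sym (*-zeroʳ c)
∑-*ˡ c f (suc k) = trans (cong (_+ c * f k) (∑-*ˡ c f k)) (sym (*-distribˡ-+ c (sum< k f) (f k)))

∑-const : ∀ c k → ∑[ i < k ] c ≡ k * c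
∑-const c zero    = refl
∑-const c (suc k) = trans (cong (_+ c) (∑-const c k)) (+-comm (k * c) c)

∑-split : ∀ f a b → sum< (a + b) f ≡ sum< a f + ∑[ i < b ] f (a + i)
∑-split f a zero    = trans (cong (λ k → sum< k f) (+-identityʳ a)) (sym (+-identityʳ _))
∑-split f a (suc b) = begin
  sum< (a + suc b) f                          ≡⟨ cong (λ k → sum< k f) (+-suc a b) ⟩
  sum< (a + b) f + f (a + b)                  ≡⟨ cong (_+ f (a + b)) (∑-split f a b) ⟩
  sum< a f + ∑[ i < b ] f (a + i) + f (a + b) ≡⟨ +-assoc (sum< a f) _ _ ⟩
  sum< a f + ∑[ i < suc b ] f (a + i)          ∎
  where open ≡-Reasoning

∑-reverse : ∀ f k → sum< k f ≡ ∑[ i < k ] f (k ∸ suc i)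
∑-reverse f zero    = refl
∑-reverse f (suc k) = begin
  sum< k f + f k                                ≡⟨ cong (_+ f k) (∑-reverse f k) ⟩
  ∑[ i < k ] f (k ∸ suc i) + f k                ≡⟨ +-comm _ (f k) ⟩
  f k + ∑[ i < k ] f (k ∸ suc i)                ≡⟨ sym (∑-split (λ i → f (suc k ∸ suc i)) 1 k) ⟩
  ∑[ i < suc k ] f (suc k ∸ suc i)               ∎
  where open ≡-Reasoning

∑-single : ∀ {f} k j → j < k → (∀ i → i < k → i ≢ j → f i ≡ 0) → sum< k f ≡ f j
∑-single {f} (suc k) j j<1+k off with m≤n⇒m<n∨m≡n (s≤s⁻¹ j<1+k)
... | inj₂ refl = cong (_+ f j) (∑-zero j λ i i<j → off i (m<n⇒m<1+n i<j) (<⇒≢ i<j))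
... | inj₁ j<k  = trans (cong₂ _+_ (∑-single k j j<k λ i i<k → off i (m<n⇒m<1+n i<k))
                                   (off k ≤-refl (>⇒≢ j<k))) (+-identityʳ (f j))

module _ {f g : ℕ → ℕ} where

  ∑-mono-≤ : ∀ k → (∀ i → i < k → f i ≤ g i) → sum< k f ≤ sum< k g
  ∑-mono-≤ zero    le = z≤n
  ∑-mono-≤ (suc k) le = +-mono-≤ (∑-mono-≤ k λ i i<k → le i (m<n⇒m<1+n i<k)) (le k ≤-refl)

  ∑-mono-< : ∀ k j → j < k → (∀ i → i < k → f i ≤ g i) → f j < g j → sum< k f < sum< k g
  ∑-mono-< (suc k) j j<1+k le lt with m≤n⇒m<n∨m≡n (s≤s⁻¹ j<1+k)
  ... | inj₂ refl = +-mono-≤-< (∑-mono-≤ k λ i i<k → le i (m<n⇒m<1+n i<k)) lt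
  ... | inj₁ j<k  = +-mono-<-≤ (∑-mono-< k j j<k (λ i i<k → le i (m<n⇒m<1+n i<k)) lt) (le k ≤-refl)

  ∑-mono-≤-equality : ∀ k → (∀ i → i < k → f i ≤ g i) → sum< k f ≡ sum< k g →
                      ∀ j → j < k → f j ≡ g j
  ∑-mono-≤-equality k le eq j j<k with m≤n⇒m<n∨m≡n (le j j<k)
  ... | inj₂ fj≡gj = fj≡gj
  ... | inj₁ fj<gj = contradiction eq (<⇒≢ (∑-mono-< k j j<k le fj<gj))

telescope : ∀ (φ a b : ℕ → ℕ) k → (∀ t → t < k → φ t + a t ≡ φ (suc t) + b t) →
            φ 0 + sum< k a ≡ φ k + sum< k b
telescope φ a b zero    step = refl
telescope φ a b (suc k) step = begin
  φ 0 + (sum< k a + a k)     ≡⟨ +-assoc (φ 0) _ _ ⟨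
  φ 0 + sum< k a + a k       ≡⟨ cong (_+ a k) (telescope φ a b k λ t t<k → step t (m<n⇒m<1+n t<k)) ⟩
  φ k + sum< k b + a k       ≡⟨ xy∙z≈xz∙y (φ k) _ _ ⟩
  φ k + a k + sum< k b       ≡⟨ cong (_+ sum< k b) (step k ≤-refl) ⟩
  φ (suc k) + b k + sum< k b ≡⟨ xy∙z≈xz∙y (φ (suc k)) _ _ ⟩
  φ (suc k) + sum< k b + b k ≡⟨ +-assoc (φ (suc k)) _ _ ⟩
  φ (suc k) + (sum< k b + b k) ∎
  where open ≡-Reasoning

∑-pairing : ∀ N {F H : ℕ → ℕ} → (∀ d → d ≤ N → F d + F (N ∸ d) ≡ H d + H (N ∸ d)) →
            ∑[ d < suc N ] F d ≡ ∑[ d < suc N ] H d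
∑-pairing N {F} {H} paired = double-injective _ _ (begin
  ∑[ d < suc N ] F d + ∑[ d < suc N ] F d           ≡⟨ cong (∑[ d < suc N ] F d +_) (∑-reverse F (suc N)) ⟩
  ∑[ d < suc N ] F d + ∑[ d < suc N ] F (N ∸ d)     ≡⟨ ∑-+ (suc N) ⟨
  ∑[ d < suc N ] (F d + F (N ∸ d))                  ≡⟨ ∑-cong (suc N) (λ d d≤N → paired d (s≤s⁻¹ d≤N)) ⟩
  ∑[ d < suc N ] (H d + H (N ∸ d))                  ≡⟨ ∑-+ (suc N) ⟩
  ∑[ d < suc N ] H d + ∑[ d < suc N ] H (N ∸ d)     ≡⟨ cong (∑[ d < suc N ] H d +_) (∑-reverse H (suc N)) ⟨
  ∑[ d < suc N ] H d + ∑[ d < suc N ] H d           ∎)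
  where open ≡-Reasoning

SymmetricOn : ℕ → (ℕ → ℕ) → Set
SymmetricOn n G = ∀ d → d ≤ n → G (n ∸ d) ≡ G d

triangleSum : ℕ → (ℕ → ℕ) → ℕ
triangleSum n G = ∑[ i < n ] ∑[ d < n ∸ i ] G d

module _ {n : ℕ} {G : ℕ → ℕ} (G-sym : SymmetricOn n G) where

  ∑-complement : ∀ i → i ≤ n → ∑[ d < n ∸ i ] G d + ∑[ d < suc i ] G d ≡ ∑[ d < suc n ] G d
  ∑-complement i i≤n = begin
    ∑[ d < n ∸ i ] G d + ∑[ d < suc i ] G d               ≡⟨ +-comm _ (∑[ d < suc i ] G d) ⟩
    ∑[ d < suc i ] G d + ∑[ d < n ∸ i ] G d               ≡⟨ cong (∑[ d < suc i ] G d +_) (∑-reverse G (n ∸ i)) ⟩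
    ∑[ d < suc i ] G d + ∑[ d < n ∸ i ] G (n ∸ i ∸ suc d) ≡⟨ cong (∑[ d < suc i ] G d +_) (∑-cong (n ∸ i) reflected) ⟩
    ∑[ d < suc i ] G d + ∑[ d < n ∸ i ] G (suc i + d)     ≡⟨ ∑-split G (suc i) (n ∸ i) ⟨
    ∑[ d < suc i + (n ∸ i) ] G d                         ≡⟨ cong (λ k → sum< (suc k) G) (m+[n∸m]≡n i≤n) ⟩
    ∑[ d < suc n ] G d                                   ∎
    where
    open ≡-Reasoning
    reflected : ∀ d → d < n ∸ i → G (n ∸ i ∸ suc d) ≡ G (suc i + d)
    reflected d d<n∸i = begin
      G (n ∸ i ∸ suc d)       ≡⟨ cong G (trans (∸-+-assoc n i (suc d)) (cong (n ∸_) (+-suc i d))) ⟩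
      G (n ∸ (suc i + d))     ≡⟨ G-sym (suc i + d) (<∸⇒+< i d<n∸i) ⟩
      G (suc i + d)           ∎

  triangle-symmetric : triangleSum n G + triangleSum n G ≡ n * ∑[ d < suc n ] G d
  triangle-symmetric = begin
    triangleSum n G + ∑[ i < n ] ∑[ d < n ∸ i ] G d             ≡⟨ cong (triangleSum n G +_) (∑-reverse _ n) ⟩
    triangleSum n G + ∑[ i < n ] ∑[ d < n ∸ (n ∸ suc i) ] G d
      ≡⟨ cong (triangleSum n G +_) (∑-cong n λ i i<n → cong (λ k → sum< k G) (m∸[m∸n]≡n i<n)) ⟩
    triangleSum n G + ∑[ i < n ] ∑[ d < suc i ] G d             ≡⟨ ∑-+ n ⟨
    ∑[ i < n ] (∑[ d < n ∸ i ] G d + ∑[ d < suc i ] G d)          ≡⟨ ∑-cong n (λ i i<n → ∑-complement i (<⇒≤ i<n)) ⟩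
    ∑[ i < n ] ∑[ d < suc n ] G d                                ≡⟨ ∑-const _ n ⟩
    n * ∑[ d < suc n ] G d                                       ∎
    where open ≡-Reasoning

∑-halves : ∀ m {G : ℕ → ℕ} → SymmetricOn (2 * m) G → G m ≡ 0 →
           ∑[ d < suc (2 * m) ] G d ≡ ∑[ d < suc m ] G d + ∑[ d < suc m ] G d
∑-halves m {G} G-sym Gm≡0 = begin
  ∑[ d < suc (2 * m) ] G d                       ≡⟨ ∑-complement G-sym m m≤2m ⟨
  ∑[ d < 2 * m ∸ m ] G d + ∑[ d < suc m ] G d    ≡⟨ cong (λ k → sum< k G + ∑[ d < suc m ] G d) 2m∸m≡m ⟩
  ∑[ d < m ] G d + ∑[ d < suc m ] G d            ≡⟨ cong (_+ ∑[ d < suc m ] G d) ∑<m≡∑≤m ⟩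
  ∑[ d < suc m ] G d + ∑[ d < suc m ] G d        ∎
  where
  open ≡-Reasoning
  m≤2m : m ≤ 2 * m
  m≤2m = subst (m ≤_) (sym (2*m≡m+m m)) (m≤m+n m m)
  2m∸m≡m : 2 * m ∸ m ≡ m
  2m∸m≡m = trans (cong (_∸ m) (2*m≡m+m m)) (m+n∸m≡n m m)
  ∑<m≡∑≤m : ∑[ d < m ] G d ≡ ∑[ d < suc m ] G d
  ∑<m≡∑≤m = trans (sym (+-identityʳ _)) (cong (∑[ d < m ] G d +_) (sym Gm≡0))

sum-agreeOff-point : ∀ {n} (f g : Fin n → ℕ) a → (∀ x → x ≢ a → f x ≡ g x) →
                     sum f + g a ≡ sum g + f a
sum-agreeOff-point {suc n} f g a agree = begin
  sum f + g a                        ≡⟨ cong (_+ g a) (sum-remove f) ⟩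
  f a + sum (removeAt f a) + g a     ≡⟨ cong (λ s → f a + s + g a) (sum-cong-≗ λ j → agree _ (punchInᵢ≢i a j)) ⟩
  f a + sum (removeAt g a) + g a     ≡⟨ swap (f a) (sum (removeAt g a)) (g a) ⟩
  g a + sum (removeAt g a) + f a     ≡⟨ cong (_+ f a) (sum-remove g) ⟨
  sum g + f a                        ∎
  where
  open ≡-Reasoning
  swap : ∀ x y z → x + y + z ≡ z + y + x
  swap = solve-∀

sumˡ-map-cong : ∀ {n} {f g : Fin n → ℕ} {xs} → All (λ x → f x ≡ g x) xs → sumˡ (map f xs) ≡ sumˡ (map g xs)
sumˡ-map-cong []         = refl
sumˡ-map-cong (eq ∷ eqs) = cong₂ _+_ eq (sumˡ-map-cong eqs)

sum-agreeOff : ∀ {n} (f g : Fin n → ℕ) (xs : List (Fin n)) → Unique xs → (∀ x → x ∉ xs → f x ≡ g x) →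
               sum f + sumˡ (map g xs) ≡ sum g + sumˡ (map f xs)
sum-agreeOff f g []       _               agree = cong (_+ 0) (sum-cong-≗ λ x → agree x λ ())
sum-agreeOff f g (a ∷ xs) (a∉xs ∷ unique) agree = begin
  sum f + (g a + sumˡ (map g xs))   ≡⟨ +-assoc (sum f) _ _ ⟨
  sum f + g a + sumˡ (map g xs)     ≡⟨ cong (λ v → sum f + v + sumˡ (map g xs)) (updateAt-updates a f) ⟨
  sum f + h a + sumˡ (map g xs)     ≡⟨ cong (_+ sumˡ (map g xs)) (sum-agreeOff-point f h a f≡h) ⟩
  sum h + f a + sumˡ (map g xs)     ≡⟨ xy∙z≈xz∙y (sum h) _ _ ⟩
  sum h + sumˡ (map g xs) + f a     ≡⟨ cong (_+ f a) (sum-agreeOff h g xs unique h≡g) ⟩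
  sum g + sumˡ (map h xs) + f a     ≡⟨ cong (λ s → sum g + s + f a) (sumˡ-map-cong (All.map h≡f a∉xs)) ⟩
  sum g + sumˡ (map f xs) + f a     ≡⟨ xy∙z≈xz∙y (sum g) _ _ ⟩
  sum g + f a + sumˡ (map f xs)     ≡⟨ +-assoc (sum g) _ _ ⟩
  sum g + (f a + sumˡ (map f xs))   ∎
  where
  open ≡-Reasoning
  h : Fin _ → ℕ
  h = updateAt f a (λ _ → g a)
  f≡h : ∀ x → x ≢ a → f x ≡ h x
  f≡h x x≢a = sym (updateAt-minimal x a f x≢a)
  h≡f : ∀ {x} → a ≢ x → h x ≡ f x
  h≡f a≢x = sym (f≡h _ (a≢x ∘ sym))
  h≡g : ∀ x → x ∉ xs → h x ≡ g x
  h≡g x x∉xs with x Fin.≟ a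
  ... | yes refl = updateAt-updates a f
  ... | no x≢a   = trans (sym (f≡h x x≢a)) (agree x λ { (here x≡a) → x≢a x≡a ; (there x∈xs) → x∉xs x∈xs })

-- Non-crossing perfect matchings

module NCPM {n : ℕ} {p : Partner n} (N : IsNCPM n p) where
  open IsNCPM N public

  partner-injective : ∀ {x y} → p x ≡ p y → x ≡ y
  partner-injective {x} {y} eq = trans (sym (involutive x)) (trans (cong p eq) (involutive y))

  partner-sym : ∀ {x y} → p x ≡ y → p y ≡ x
  partner-sym {x} refl = involutive x

  partner-≢ : ∀ {x y} → p x ≡ y → x ≢ y
  partner-≢ {x} px≡y x≡y = fixpt-free x (trans px≡y (sym x≡y))

  toℕ-partner-≢ : ∀ {x y} → p x ≡ y → toℕ x ≢ toℕ y
  toℕ-partner-≢ px≡y = partner-≢ px≡y ∘ toℕ-injective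

  Closed : ℕ → ℕ → Set
  Closed l u = ∀ y → l ≤ toℕ y → toℕ y < u → l ≤ toℕ (p y) × toℕ (p y) < u

  nested : ∀ x → Closed (suc (toℕ x)) (toℕ (p x))
  nested x y x<y y<px with <-cmp (toℕ (p y)) (toℕ x)
  ... | tri< py<x _ _ = ⊥-elim (noncrossing (p y) x y (p x) py<x x<y y<px (involutive y) refl)
  ... | tri≈ _ py≡x _ = ⊥-elim (<-irrefl (cong toℕ (trans (sym (involutive y)) (cong p (toℕ-injective py≡x)))) y<px)
  ... | tri> _ _ x<py with <-cmp (toℕ (p y)) (toℕ (p x))
  ...   | tri< py<px _ _ = x<py , py<px
  ...   | tri≈ _ py≡px _ = ⊥-elim (>⇒≢ x<y (cong toℕ (partner-injective (toℕ-injective py≡px))))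
  ...   | tri> _ _ px<py = ⊥-elim (noncrossing x y (p x) (p y) x<y y<px px<py refl refl)

  -- The partner P of the leftmost point l splits [l, l + w) into the closed (l, P) and (P, l + w).
  closed-even : ∀ w l → l + w ≤ n → Closed l (l + w) → w % 2 ≡ 0
  closed-even = <-rec _ step
    where
    step : ∀ w → (∀ {v} → v < w → ∀ l → l + v ≤ n → Closed l (l + v) → v % 2 ≡ 0) →
           ∀ l → l + w ≤ n → Closed l (l + w) → w % 2 ≡ 0
    step zero    _   _ _ _ = refl
    step (suc w) rec l l+w≤n closed
      with fromℕ< (<-≤-trans (m<m+n l z<s) l+w≤n) | toℕ-fromℕ< (<-≤-trans (m<m+n l z<s) l+w≤n)
    ... | y₀ | refl with closed y₀ ≤-refl (m<m+n _ z<s)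
    ... | l≤P , P<u with ≤∧≢⇒< l≤P (toℕ-partner-≢ refl)
    ... | l<P with m≤n⇒∃[o]m+o≡n l<P | m≤n⇒∃[o]m+o≡n P<u
    ... | a , l+a≡P | b , P+b≡u = subst (λ v → suc v % 2 ≡ 0) (sym w≡) a+b-even
      where
      P : ℕ
      P = toℕ (p y₀)

      w≡ : w ≡ suc (a + b)
      w≡ = suc-injective (+-cancelˡ-≡ (toℕ y₀) _ _ (begin
        toℕ y₀ + suc w                 ≡⟨ P+b≡u ⟨
        suc P + b                      ≡⟨ cong (λ v → suc v + b) l+a≡P ⟨
        suc (suc (toℕ y₀) + a) + b     ≡⟨ shuffle (toℕ y₀) a b ⟩
        toℕ y₀ + suc (suc (a + b))     ∎))
        where
        open ≡-Reasoning
        shuffle : ∀ l a b → suc (suc l + a) + b ≡ l + suc (suc (a + b))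
        shuffle = solve-∀

      inside : Closed (suc (toℕ y₀)) (suc (toℕ y₀) + a)
      inside = subst (Closed (suc (toℕ y₀))) (sym l+a≡P) (nested y₀)

      beyond : ∀ y → P < toℕ y → toℕ y₀ ≤ toℕ (p y) → P < toℕ (p y)
      beyond y P<y l≤py with <-cmp (toℕ (p y)) P
      ... | tri> _ _ P<py = P<py
      ... | tri≈ _ py≡P _ = ⊥-elim (<-asym l<P (subst (λ z → P < toℕ z) (partner-injective (toℕ-injective py≡P)) P<y))
      ... | tri< py<P _ _ with m≤n⇒m<n∨m≡n l≤py
      ...   | inj₂ l≡py = ⊥-elim (<-irrefl (cong toℕ (partner-sym (toℕ-injective (sym l≡py)))) P<y)
      ...   | inj₁ l<py = ⊥-elim (<-asym P<y (subst (λ z → toℕ z < P) (involutive y) (proj₂ (nested y₀ (p y) l<py py<P))))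

      outside : Closed (suc P) (suc P + b)
      outside y P<y y<u = beyond y P<y (proj₁ in-u) , subst (toℕ (p y) <_) (sym P+b≡u) (proj₂ in-u)
        where
        in-u : toℕ y₀ ≤ toℕ (p y) × toℕ (p y) < toℕ y₀ + suc w
        in-u = closed y (<⇒≤ (<-trans l<P P<y)) (subst (toℕ y <_) P+b≡u y<u)

      a<1+w : a < suc w
      a<1+w = s≤s (≤-trans (m≤m+n a b) (≤-trans (n≤1+n _) (≤-reflexive (sym w≡))))

      b<1+w : b < suc w
      b<1+w = s≤s (≤-trans (m≤n+m b a) (≤-trans (n≤1+n _) (≤-reflexive (sym w≡))))

      a+b-even : (a + b) % 2 ≡ 0
      a+b-even = trans (%-distribˡ-+ a b 2) (cong₂ (λ x y → (x + y) % 2)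
        (rec a<1+w (suc (toℕ y₀)) (subst (_≤ n) (sym l+a≡P) (<⇒≤ (toℕ<n (p y₀)))) inside)
        (rec b<1+w (suc P) (subst (_≤ n) (sym P+b≡u) l+w≤n) outside))

  edge-odd : ∀ x → toℕ x < toℕ (p x) → (toℕ (p x) ∸ toℕ x) % 2 ≡ 1
  edge-odd x x<px with m≤n⇒∃[o]m+o≡n x<px
  ... | a , x+a≡px = begin
    (toℕ (p x) ∸ toℕ x) % 2      ≡⟨ cong (λ v → (v ∸ toℕ x) % 2) x+a≡px ⟨
    (suc (toℕ x) + a ∸ toℕ x) % 2
      ≡⟨ cong (_% 2) (trans (cong (_∸ toℕ x) (sym (+-suc (toℕ x) a))) (m+n∸m≡n (toℕ x) (suc a))) ⟩
    (1 + a) % 2                   ≡⟨ %-distribˡ-+ 1 a 2 ⟩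
    (1 + a % 2) % 2               ≡⟨ cong (λ v → (1 + v) % 2) a-even ⟩
    1                             ∎
    where
    open ≡-Reasoning
    a-even : a % 2 ≡ 0
    a-even = closed-even a (suc (toℕ x)) (subst (_≤ n) (sym x+a≡px) (<⇒≤ (toℕ<n (p x))))
                         (subst (Closed (suc (toℕ x))) (sym x+a≡px) (nested x))

ncpm-cong : ∀ {n} {M M' : Partner n} → M ≈M M' → IsNCPM n M → IsNCPM n M'
ncpm-cong {M = M} {M'} M≈M' N = record
  { involutive  = λ x → trans (sym (M≈M' (M' x))) (trans (cong M (sym (M≈M' x))) (involutive x))
  ; fixpt-free  = λ x → fixpt-free x ∘ trans (M≈M' x)
  ; noncrossing = λ a b c d a<b b<c c<d Ma≡c → noncrossing a b c d a<b b<c c<d (trans (M≈M' a) Ma≡c) ∘ trans (M≈M' b)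
  }
  where
  open IsNCPM N

span : ℕ → ℕ → ℕ
span n d = ((d ∸ 1) ⊓ (n ∸ 1 ∸ d)) / 2

edgeLength-comm : ∀ {n} (x y : Fin n) → edgeLength x y ≡ edgeLength y x
edgeLength-comm {n} x y = cong (span n) (∣-∣-comm (toℕ x) (toℕ y))

span-inner : ∀ n d → span n d * 2 ≤ d ∸ 1
span-inner n d = ≤-trans (m/n*n≤m _ 2) (m⊓n≤m (d ∸ 1) (n ∸ 1 ∸ d))

span-outer : ∀ n d → span n d * 2 ≤ n ∸ 1 ∸ d
span-outer n d = ≤-trans (m/n*n≤m _ 2) (m⊓n≤n (d ∸ 1) (n ∸ 1 ∸ d))

span-gap : ∀ n x g → span n ∣ x - suc x + g ∣ * 2 ≤ g
span-gap n x g = subst (λ d → span n ∣ x - suc x + g ∣ * 2 ≤ d ∸ 1) distance (span-inner n ∣ x - suc x + g ∣)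
  where
  distance : ∣ x - suc x + g ∣ ≡ suc g
  distance = trans (cong ∣ x -_∣ (sym (+-suc x g))) (∣m-m+n∣≡n x (suc g))

span-wrap : ∀ x d g → span (suc (x + d + g)) ∣ x + d - x ∣ * 2 ≤ x + g
span-wrap x d g = subst₂ (λ e f → span (suc (x + d + g)) e * 2 ≤ f) distance complement
                         (span-outer (suc (x + d + g)) ∣ x - x + d ∣)
  where
  +-right-comm : ∀ a b c → a + b + c ≡ a + c + b
  +-right-comm = solve-∀
  distance : ∣ x - x + d ∣ ≡ ∣ x + d - x ∣
  distance = ∣-∣-comm x (x + d)
  complement : x + d + g ∸ ∣ x - x + d ∣ ≡ x + g
  complement = trans (cong₂ _∸_ (+-right-comm x d g) (∣m-m+n∣≡n x d)) (m+n∸n≡m (x + g) d)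

-- Each side is bounded by the points beyond it, and for sorted corners these four sets of
-- points are disjoint and avoid the corners.
sorted-span-bound : ∀ n P Q R S → P < Q → Q < R → R < S → S < n →
  (span n ∣ P - Q ∣ + span n ∣ Q - R ∣ + span n ∣ R - S ∣ + span n ∣ S - P ∣) * 2 + 4 ≤ n
sorted-span-bound n P _ _ _ P<Q Q<R R<S S<n
  with m≤n⇒∃[o]m+o≡n P<Q | m≤n⇒∃[o]m+o≡n Q<R | m≤n⇒∃[o]m+o≡n R<S | m≤n⇒∃[o]m+o≡n S<n
... | g₁ , refl | g₂ , refl | g₃ , refl | g₄ , refl = begin
  (ℓ₁ + ℓ₂ + ℓ₃ + ℓ₄) * 2 + 4              ≡⟨ distrib ℓ₁ ℓ₂ ℓ₃ ℓ₄ ⟩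
  ℓ₁ * 2 + ℓ₂ * 2 + ℓ₃ * 2 + ℓ₄ * 2 + 4    ≤⟨ +-monoˡ-≤ 4 (+-mono-≤ (+-mono-≤ (+-mono-≤
                                                 (span-gap n P g₁) (span-gap n (suc P + g₁) g₂))
                                                 (span-gap n (suc (suc P + g₁) + g₂) g₃)) wrap) ⟩
  g₁ + g₂ + g₃ + (P + g₄) + 4               ≡⟨ total P g₁ g₂ g₃ g₄ ⟩
  suc (suc (suc (suc P + g₁) + g₂) + g₃) + g₄ ∎
  where
  open ≤-Reasoning
  S ℓ₁ ℓ₂ ℓ₃ ℓ₄ : ℕ
  S = suc (suc (suc P + g₁) + g₂) + g₃
  ℓ₁ = span n ∣ P - suc P + g₁ ∣
  ℓ₂ = span n ∣ suc P + g₁ - suc (suc P + g₁) + g₂ ∣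
  ℓ₃ = span n ∣ suc (suc P + g₁) + g₂ - S ∣
  ℓ₄ = span n ∣ S - P ∣
  distrib : ∀ a b c d → (a + b + c + d) * 2 + 4 ≡ a * 2 + b * 2 + c * 2 + d * 2 + 4
  distrib = solve-∀
  total : ∀ x a b c d → a + b + c + (x + d) + 4 ≡ suc (suc (suc (suc x + a) + b) + c) + d
  total = solve-∀
  S≡ : S ≡ P + (3 + (g₁ + g₂ + g₃))
  S≡ = shift P g₁ g₂ g₃
    where
    shift : ∀ x a b c → suc (suc (suc x + a) + b) + c ≡ x + (3 + (a + b + c))
    shift = solve-∀
  wrap : ℓ₄ * 2 ≤ P + g₄
  wrap = subst (λ z → span (suc z + g₄) ∣ z - P ∣ * 2 ≤ P + g₄) (sym S≡) (span-wrap P _ g₄)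

span-complement : ∀ n d → d ≤ n → span n (n ∸ d) ≡ span n d
span-complement n d d≤n = cong (_/ 2) (trans (cong₂ _⊓_ left right) (⊓-comm (n ∸ 1 ∸ d) (d ∸ 1)))
  where
  left : n ∸ d ∸ 1 ≡ n ∸ 1 ∸ d
  left = trans (∸-+-assoc n d 1) (trans (cong (n ∸_) (+-comm d 1)) (sym (∸-+-assoc n 1 d)))
  right : n ∸ 1 ∸ (n ∸ d) ≡ d ∸ 1
  right = trans (∸-+-assoc n 1 (n ∸ d)) (trans (cong (n ∸_) (+-comm 1 (n ∸ d)))
                (trans (sym (∸-+-assoc n (n ∸ d) 1)) (cong (_∸ 1) (m∸[m∸n]≡n d≤n))))

inner≤outer : ∀ {n} d → d + d ≤ n → d ∸ 1 ≤ n ∸ 1 ∸ d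
inner≤outer zero    _      = z≤n
inner≤outer {n} (suc d) 2d≤n = subst (d ≤_) (sym (∸-+-assoc n 1 (suc d)))
                                 (m+n≤o⇒m≤o∸n d (subst (_≤ n) (sym (+-suc d (suc d))) 2d≤n))

span-odd : ∀ n d → d % 2 ≡ 1 → d + d ≤ n → span n d ≡ d / 2
span-odd n d odd d+d≤n = begin
  ((d ∸ 1) ⊓ (n ∸ 1 ∸ d)) / 2     ≡⟨ cong (_/ 2) (m≤n⇒m⊓n≡m (inner≤outer d d+d≤n)) ⟩
  (d ∸ 1) / 2                    ≡⟨ cong (λ k → (k ∸ 1) / 2) (odd-split d odd) ⟩
  d / 2 * 2 / 2                  ≡⟨ m*n/n≡m (d / 2) 2 ⟩
  d / 2                          ∎
  where open ≡-Reasoning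

-- The quadrilateral of a flip

module _ {n : ℕ} where

  opaque
    perimeter : Fin n → Fin n → Fin n → Fin n → ℕ
    perimeter p q r s = edgeLength p q + edgeLength q r + edgeLength r s + edgeLength s p

  Bounded : Fin n → Fin n → Fin n → Fin n → Set
  Bounded p q r s = perimeter p q r s * 2 + 4 ≤ n

  opaque
    unfolding perimeter

    perimeter-rotate : ∀ p q r s → perimeter q r s p ≡ perimeter p q r s
    perimeter-rotate p q r s = rotate (edgeLength p q) (edgeLength q r) (edgeLength r s) (edgeLength s p)
      where
      rotate : ∀ a b c d → b + c + d + a ≡ a + b + c + d
      rotate = solve-∀

    perimeter-reflect : ∀ p q r s → perimeter p s r q ≡ perimeter p q r s
    perimeter-reflect p q r s = begin
      edgeLength p s + edgeLength s r + edgeLength r q + edgeLength q p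
        ≡⟨ cong₂ _+_ (cong₂ _+_ (cong₂ _+_ (edgeLength-comm p s) (edgeLength-comm s r)) (edgeLength-comm r q))
                     (edgeLength-comm q p) ⟩
      edgeLength s p + edgeLength r s + edgeLength q r + edgeLength p q
        ≡⟨ reverse (edgeLength p q) (edgeLength q r) (edgeLength r s) (edgeLength s p) ⟩
      edgeLength p q + edgeLength q r + edgeLength r s + edgeLength s p ∎
      where
      open ≡-Reasoning
      reverse : ∀ a b c d → d + c + b + a ≡ a + b + c + d
      reverse = solve-∀

    bounded-sorted : ∀ {p q r s} → toℕ p < toℕ q → toℕ q < toℕ r → toℕ r < toℕ s → Bounded p q r s
    bounded-sorted {s = s} p<q q<r r<s = sorted-span-bound n _ _ _ _ p<q q<r r<s (toℕ<n s)

  bounded-rotate : ∀ {p q r s} → Bounded q r s p → Bounded p q r s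
  bounded-rotate {p} {q} {r} {s} = subst (λ x → x * 2 + 4 ≤ n) (perimeter-rotate p q r s)

  bounded-reflect : ∀ {p q r s} → Bounded p s r q → Bounded p q r s
  bounded-reflect {p} {q} {r} {s} = subst (λ x → x * 2 + 4 ≤ n) (perimeter-reflect p q r s)

  record Quadrilateral (M M' : Partner n) (p q r s : Fin n) : Set where
    field
      pq∈M  : M p ≡ q
      rs∈M  : M r ≡ s
      qr∈M' : M' q ≡ r
      sp∈M' : M' s ≡ p
      p≢r   : p ≢ r
      q≢s   : q ≢ s

  module _ {M M' : Partner n} (N : IsNCPM n M) (N' : IsNCPM n M') where
    private
      module N  = NCPM N
      module N' = NCPM N'

    rotate : ∀ {p q r s} → Quadrilateral M M' p q r s → Quadrilateral M' M q r s p
    rotate Q = record { pq∈M = qr∈M' ; rs∈M = sp∈M' ; qr∈M' = rs∈M ; sp∈M' = pq∈M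
                      ; p≢r = q≢s ; q≢s = p≢r ∘ sym }
      where open Quadrilateral Q

    reflect : ∀ {p q r s} → Quadrilateral M M' p q r s → Quadrilateral M' M p s r q
    reflect Q = record { pq∈M = N'.partner-sym sp∈M' ; rs∈M = N'.partner-sym qr∈M'
                       ; qr∈M' = N.partner-sym rs∈M ; sp∈M' = N.partner-sym pq∈M
                       ; p≢r = p≢r ; q≢s = q≢s ∘ sym }
      where open Quadrilateral Q

    -- With p least and q < s, noncrossing of M and of M′ leaves only the cyclic order p < q < r < s.
    module _ {p q r s} (Q : Quadrilateral M M' p q r s) where
      open Quadrilateral Q

      bounded-least : toℕ p < toℕ q → toℕ p < toℕ r → toℕ q < toℕ s → Bounded p q r s
      bounded-least p<q p<r q<s with <-cmp (toℕ q) (toℕ r) | <-cmp (toℕ r) (toℕ s)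
      ... | tri< q<r _ _ | tri< r<s _ _ = bounded-sorted p<q q<r r<s
      ... | tri> _ _ r<q | _            = ⊥-elim (N.noncrossing p r q s p<r r<q q<s pq∈M rs∈M)
      ... | tri< q<r _ _ | tri> _ _ s<r = ⊥-elim (N'.noncrossing p q s r p<q q<s s<r (N'.partner-sym sp∈M') qr∈M')
      ... | tri≈ _ q≡r _ | _            = ⊥-elim (N'.toℕ-partner-≢ qr∈M' q≡r)
      ... | tri< _ _ _   | tri≈ _ r≡s _ = ⊥-elim (N.toℕ-partner-≢ rs∈M r≡s)

  bounded-min : ∀ {M M' p q r s} (N : IsNCPM n M) (N' : IsNCPM n M') → Quadrilateral M M' p q r s →
                toℕ p ≤ toℕ q → toℕ p ≤ toℕ r → toℕ p ≤ toℕ s → Bounded p q r s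
  bounded-min {q = q} {s = s} N N' Q p≤q p≤r p≤s = by-order (<-cmp (toℕ q) (toℕ s))
    where
    open Quadrilateral Q
    p<q : toℕ _ < toℕ q
    p<r : toℕ _ < toℕ _
    p<s : toℕ _ < toℕ s
    p<q = ≤∧≢⇒< p≤q (NCPM.toℕ-partner-≢ N pq∈M)
    p<r = ≤∧≢⇒< p≤r (p≢r ∘ toℕ-injective)
    p<s = ≤∧≢⇒< p≤s (≢-sym (NCPM.toℕ-partner-≢ N' sp∈M'))
    by-order : Tri (toℕ q < toℕ s) (toℕ q ≡ toℕ s) (toℕ s < toℕ q) → Bounded _ q _ s
    by-order (tri< q<s _ _) = bounded-least N N' Q p<q p<r q<s
    by-order (tri≈ _ q≡s _) = ⊥-elim (q≢s (toℕ-injective q≡s))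
    by-order (tri> _ _ s<q) = bounded-reflect (bounded-least N' N (reflect N N' Q) p<s p<r s<q)

  module _ {M M' p q r s} (N : IsNCPM n M) (N' : IsNCPM n M') (Q : Quadrilateral M M' p q r s) where
    private
      least-p : toℕ p ≤ toℕ q → toℕ p ≤ toℕ r → toℕ p ≤ toℕ s → Bounded p q r s
      least-p = bounded-min N N' Q

      least-q : toℕ q ≤ toℕ r → toℕ q ≤ toℕ s → toℕ q ≤ toℕ p → Bounded p q r s
      least-q q≤r q≤s q≤p = bounded-rotate (bounded-min N' N (rotate N N' Q) q≤r q≤s q≤p)

      least-r : toℕ r ≤ toℕ s → toℕ r ≤ toℕ p → toℕ r ≤ toℕ q → Bounded p q r s
      least-r r≤s r≤p r≤q = bounded-rotate (bounded-rotate (bounded-min N N' (rotate N' N (rotate N N' Q)) r≤s r≤p r≤q))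

      least-s : toℕ s ≤ toℕ p → toℕ s ≤ toℕ q → toℕ s ≤ toℕ r → Bounded p q r s
      least-s s≤p s≤q s≤r = bounded-rotate (bounded-rotate (bounded-rotate
        (bounded-min N' N (rotate N N' (rotate N' N (rotate N N' Q))) s≤p s≤q s≤r)))

    quadrilateral-bounded : Bounded p q r s
    quadrilateral-bounded with ≤-total (toℕ p) (toℕ q) | ≤-total (toℕ r) (toℕ s)
    ... | inj₁ p≤q | inj₁ r≤s with ≤-total (toℕ p) (toℕ r)
    ...   | inj₁ p≤r = least-p p≤q p≤r (≤-trans p≤r r≤s)
    ...   | inj₂ r≤p = least-r r≤s r≤p (≤-trans r≤p p≤q)
    quadrilateral-bounded | inj₁ p≤q | inj₂ s≤r with ≤-total (toℕ p) (toℕ s)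
    ...   | inj₁ p≤s = least-p p≤q (≤-trans p≤s s≤r) p≤s
    ...   | inj₂ s≤p = least-s s≤p (≤-trans s≤p p≤q) s≤r
    quadrilateral-bounded | inj₂ q≤p | inj₁ r≤s with ≤-total (toℕ q) (toℕ r)
    ...   | inj₁ q≤r = least-q q≤r (≤-trans q≤r r≤s) q≤p
    ...   | inj₂ r≤q = least-r r≤s (≤-trans r≤q q≤p) r≤q
    quadrilateral-bounded | inj₂ q≤p | inj₂ s≤r with ≤-total (toℕ q) (toℕ s)
    ...   | inj₁ q≤s = least-q (≤-trans q≤s s≤r) q≤s q≤p
    ...   | inj₂ s≤q = least-s (≤-trans s≤q q≤p) s≤q s≤r

flipLength : ∀ {n} → Quad n → ℕ
flipLength (quad a b c d) = edgeLength a b + edgeLength c d + edgeLength a c + edgeLength b d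

opaque
  unfolding perimeter

  perimeter-flip : ∀ {n} (a b c d : Fin n) → perimeter a b d c ≡ flipLength (quad a b c d)
  perimeter-flip a b c d = begin
    edgeLength a b + edgeLength b d + edgeLength d c + edgeLength c a
      ≡⟨ cong₂ (λ x y → edgeLength a b + edgeLength b d + x + y) (edgeLength-comm d c) (edgeLength-comm c a) ⟩
    edgeLength a b + edgeLength b d + edgeLength c d + edgeLength a c
      ≡⟨ swap (edgeLength a b) (edgeLength b d) (edgeLength c d) (edgeLength a c) ⟩
    flipLength (quad a b c d) ∎
    where
    open ≡-Reasoning
    swap : ∀ w x y z → w + x + y + z ≡ w + y + z + x
    swap = solve-∀

*2+4≤2*⇒≤∸2 : ∀ x m → x * 2 + 4 ≤ 2 * m → x ≤ m ∸ 2
*2+4≤2*⇒≤∸2 x m le = *-cancelʳ-≤ x (m ∸ 2) 2 (begin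
  x * 2         ≤⟨ m+n≤o⇒m≤o∸n (x * 2) le ⟩
  2 * m ∸ 4     ≡⟨ cong (_∸ 4) (*-comm 2 m) ⟩
  m * 2 ∸ 2 * 2 ≡⟨ *-distribʳ-∸ 2 m 2 ⟨
  (m ∸ 2) * 2   ∎)
  where open ≤-Reasoning

flipLength-bound : ∀ m {M M' : Partner (2 * m)} {q} → IsNCPM (2 * m) M → IsNCPM (2 * m) M' → IsFlip M M' q →
                   flipLength q ≤ m ∸ 2
flipLength-bound m {q = quad a b c d} N N' flip =
  *2+4≤2*⇒≤∸2 _ m (subst (λ x → x * 2 + 4 ≤ 2 * m) (perimeter-flip a b c d)
  (quadrilateral-bounded N N' record { pq∈M = ab∈M ; rs∈M = NCPM.partner-sym N cd∈M ; qr∈M' = bd∈M'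
                                      ; sp∈M' = NCPM.partner-sym N' ac∈M' ; p≢r = a≢d ; q≢s = b≢c }))
  where open IsFlip flip

-- The length potential

-- Every edge of M is counted from both of its ends.
potential : ∀ {n} → Partner n → ℕ
potential M = sum λ x → edgeLength x (M x)

addedLength removedLength : ∀ {n} → Quad n → ℕ
addedLength   (quad a b c d) = edgeLength a c + edgeLength b d
removedLength (quad a b c d) = edgeLength a b + edgeLength c d

flipLength-split : ∀ {n} (q : Quad n) → flipLength q ≡ removedLength q + addedLength q
flipLength-split (quad a b c d) = +-assoc (edgeLength a b + edgeLength c d) _ _

potential-flip : ∀ {n} {M M' : Partner n} {q} → IsNCPM n M → IsNCPM n M' → IsFlip M M' q →
                 potential M + 2 * addedLength q ≡ potential M' + 2 * removedLength q
potential-flip {M = M} {M'} {quad a b c d} N N' flip = begin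
  potential M + 2 * (edgeLength a c + edgeLength b d)   ≡⟨ cong (potential M +_) added-twice ⟨
  potential M + (ℓ' a + (ℓ' b + (ℓ' c + (ℓ' d + 0))))   ≡⟨ sum-agreeOff ℓ ℓ' (a ∷ b ∷ c ∷ d ∷ []) distinct unchanged ⟩
  potential M' + (ℓ a + (ℓ b + (ℓ c + (ℓ d + 0))))      ≡⟨ cong (potential M' +_) removed-twice ⟩
  potential M' + 2 * (edgeLength a b + edgeLength c d)  ∎
  where
  open ≡-Reasoning
  open IsFlip flip

  ℓ ℓ' : Fin _ → ℕ
  ℓ  x = edgeLength x (M x)
  ℓ' x = edgeLength x (M' x)

  at-partner : ∀ {P : Partner _} x {y} → P x ≡ y → edgeLength x (P x) ≡ edgeLength y x
  at-partner x refl = edgeLength-comm x _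

  cong₄ : ∀ {w x y z w′ x′ y′ z′} → w ≡ w′ → x ≡ x′ → y ≡ y′ → z ≡ z′ →
          w + (x + (y + (z + 0))) ≡ w′ + (x′ + (y′ + (z′ + 0)))
  cong₄ refl refl refl refl = refl

  double-pairs : ∀ u v → u + (u + (v + (v + 0))) ≡ 2 * (u + v)
  double-pairs = solve-∀

  double-alternating : ∀ u v → u + (v + (u + (v + 0))) ≡ 2 * (u + v)
  double-alternating = solve-∀

  added-twice : ℓ' a + (ℓ' b + (ℓ' c + (ℓ' d + 0))) ≡ 2 * (edgeLength a c + edgeLength b d)
  added-twice = trans (cong₄ (cong (edgeLength a) ac∈M') (cong (edgeLength b) bd∈M')
                             (at-partner {M'} c (NCPM.partner-sym N' ac∈M')) (at-partner {M'} d (NCPM.partner-sym N' bd∈M')))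
                      (double-alternating (edgeLength a c) (edgeLength b d))

  removed-twice : ℓ a + (ℓ b + (ℓ c + (ℓ d + 0))) ≡ 2 * (edgeLength a b + edgeLength c d)
  removed-twice = trans (cong₄ (cong (edgeLength a) ab∈M) (at-partner {M} b (NCPM.partner-sym N ab∈M))
                               (cong (edgeLength c) cd∈M) (at-partner {M} d (NCPM.partner-sym N cd∈M)))
                        (double-pairs (edgeLength a b) (edgeLength c d))

  distinct : Unique (a ∷ b ∷ c ∷ d ∷ [])
  distinct = (NCPM.partner-≢ N ab∈M ∷ a≢c ∷ a≢d ∷ []) ∷ (b≢c ∷ b≢d ∷ []) ∷ (NCPM.partner-≢ N cd∈M ∷ []) ∷ [] ∷ []

  unchanged : ∀ x → x ∉ a ∷ b ∷ c ∷ d ∷ [] → ℓ x ≡ ℓ' x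
  unchanged x x∉ = cong (edgeLength x) (sym (others x (x∉ ∘ here) (x∉ ∘ there ∘ here)
                                                     (x∉ ∘ there ∘ there ∘ here) (x∉ ∘ there ∘ there ∘ there ∘ here)))

odd-part : ∀ d {x y} → (d % 2 ≡ 1 → x ≡ y) → d % 2 * x ≡ d % 2 * y
odd-part d eq with %2-cases d
... | inj₁ even rewrite even = refl
... | inj₂ odd  rewrite odd  = cong (_+ 0) (eq refl)

-- The edge {i, i + d} of E_m is weighted by w i (i + d); d % 2 is the indicator of d odd.
-- Opaque, so that unification sees ∑E n w rather than its unfolding.
opaque
  ∑E : ℕ → (ℕ → ℕ → ℕ) → ℕ
  ∑E n w = ∑[ i < n ] ∑[ d < n ∸ i ] (d % 2 * w i (i + d))

opaque
  unfolding ∑E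

  ∑E-cong : ∀ n {w w′ : ℕ → ℕ → ℕ} → (∀ i d → i + d < n → d % 2 ≡ 1 → w i (i + d) ≡ w′ i (i + d)) →
            ∑E n w ≡ ∑E n w′
  ∑E-cong n eq = ∑-cong n λ i _ → ∑-cong (n ∸ i) λ d d<n∸i → odd-part d (eq i d (<∸⇒+< i d<n∸i))

  ∑E-cong-≗ : ∀ n {w w′ : ℕ → ℕ → ℕ} → (∀ i j → w i j ≡ w′ i j) → ∑E n w ≡ ∑E n w′
  ∑E-cong-≗ n {w} {w′} eq = ∑E-cong n {w} {w′} λ i d _ _ → eq i (i + d)

  ∑E-zero : ∀ n {w : ℕ → ℕ → ℕ} → (∀ i j → w i j ≡ 0) → ∑E n w ≡ 0
  ∑E-zero n w≡0 = ∑-zero n λ i _ → ∑-zero (n ∸ i) λ d _ → trans (cong (d % 2 *_) (w≡0 i (i + d))) (*-zeroʳ (d % 2))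

  ∑E-+ : ∀ n (w w′ : ℕ → ℕ → ℕ) → ∑E n (λ i j → w i j + w′ i j) ≡ ∑E n w + ∑E n w′
  ∑E-+ n w w′ = trans (∑-cong n λ i _ → trans (∑-cong (n ∸ i) λ d _ → *-distribˡ-+ (d % 2) _ _) (∑-+ (n ∸ i))) (∑-+ n)

  ∑E-distance : ∀ n (g : ℕ → ℕ) → ∑E n (λ i j → g ∣ i - j ∣) ≡ ∑[ i < n ] ∑[ d < n ∸ i ] (d % 2 * g d)
  ∑E-distance n g = ∑-cong n λ i _ → ∑-cong (n ∸ i) λ d _ → cong (λ e → d % 2 * g e) (∣m-m+n∣≡n i d)

  ∑E-*ˡ : ∀ n c (w : ℕ → ℕ → ℕ) → ∑E n (λ i j → c * w i j) ≡ c * ∑E n w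
  ∑E-*ˡ n c w = trans (∑-cong n λ i _ → trans (∑-cong (n ∸ i) λ d _ → x∙yz≈y∙xz (d % 2) c _)
                                               (∑-*ˡ c _ (n ∸ i)))
                      (∑-*ˡ c _ n)

ind-true : ∀ {b} → T b → ind b ≡ 1
ind-true {true} _ = refl

ind-false : ∀ {b} → ¬ T b → ind b ≡ 0
ind-false {false} _   = refl
ind-false {true}  ¬tt = ⊥-elim (¬tt _)

module _ {n} (x y : Fin n) where

  sameEdge-sound : ∀ {i j} → T (sameEdge (i , j) x y) → (toℕ x ≡ i × toℕ y ≡ j) ⊎ (toℕ x ≡ j × toℕ y ≡ i)
  sameEdge-sound t with Equivalence.to T-∨ t
  ... | inj₁ t′ = let x≡i , y≡j = Equivalence.to T-∧ t′ in inj₁ (≡ᵇ⇒≡ _ _ x≡i , ≡ᵇ⇒≡ _ _ y≡j)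
  ... | inj₂ t′ = let x≡j , y≡i = Equivalence.to T-∧ t′ in inj₂ (≡ᵇ⇒≡ _ _ x≡j , ≡ᵇ⇒≡ _ _ y≡i)

  sameEdge-complete : T (sameEdge (toℕ x , toℕ y) x y)
  sameEdge-complete = Equivalence.from (T-∨ {(toℕ x ≡ᵇ toℕ x) ∧ (toℕ y ≡ᵇ toℕ y)})
    (inj₁ (Equivalence.from (T-∧ {toℕ x ≡ᵇ toℕ x}) (≡⇒≡ᵇ (toℕ x) _ refl , ≡⇒≡ᵇ (toℕ y) _ refl)))

  opaque
    unfolding ∑E

    ∑E-sameEdge : ∀ (w : ℕ → ℕ → ℕ) → toℕ x < toℕ y → (toℕ y ∸ toℕ x) % 2 ≡ 1 →
                  ∑E n (λ i j → w i j * ind (sameEdge (i , j) x y)) ≡ w (toℕ x) (toℕ y)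
    ∑E-sameEdge w x<y odd = begin
      ∑E n f                               ≡⟨ ∑-single n X (toℕ<n x) off-row ⟩
      ∑[ d < n ∸ X ] term X d               ≡⟨ ∑-single (n ∸ X) e (∸-monoˡ-< (toℕ<n y) (<⇒≤ x<y)) off-column ⟩
      term X e                              ≡⟨ cong₂ (λ u v → u * (w X (X + e) * v)) odd (ind-true on-edge) ⟩
      1 * (w X (X + e) * 1)                 ≡⟨ trans (*-identityˡ _) (*-identityʳ _) ⟩
      w X (X + e)                           ≡⟨ cong (w X) X+e≡Y ⟩
      w X Y                                 ∎
      where
      open ≡-Reasoning
      X Y e : ℕ
      X = toℕ x
      Y = toℕ y
      e = Y ∸ X
      X+e≡Y : X + e ≡ Y
      X+e≡Y = m+[n∸m]≡n (<⇒≤ x<y)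
      f term : ℕ → ℕ → ℕ
      f i j = w i j * ind (sameEdge (i , j) x y)
      term i d = d % 2 * f i (i + d)

      on-edge : T (sameEdge (X , X + e) x y)
      on-edge = subst (λ j → T (sameEdge (X , j) x y)) (sym X+e≡Y) sameEdge-complete

      term-zero : ∀ i d → ¬ T (sameEdge (i , i + d) x y) → term i d ≡ 0
      term-zero i d off = trans (cong (λ v → d % 2 * (w i (i + d) * v)) (ind-false off))
                                (trans (cong (d % 2 *_) (*-zeroʳ (w i (i + d)))) (*-zeroʳ (d % 2)))

      off-row : ∀ i → i < n → i ≢ X → ∑[ d < n ∸ i ] term i d ≡ 0
      off-row i _ i≢X = ∑-zero (n ∸ i) λ d _ → term-zero i d λ t → case sameEdge-sound t of λ where
        (inj₁ (X≡i , _))     → i≢X (sym X≡i)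
        (inj₂ (X≡i+d , Y≡i)) → <⇒≱ (subst₂ _<_ X≡i+d Y≡i x<y) (m≤m+n i d)

      off-column : ∀ d → d < n ∸ X → d ≢ e → term X d ≡ 0
      off-column d _ d≢e = term-zero X d λ t → case sameEdge-sound t of λ where
        (inj₁ (_ , Y≡X+d)) → d≢e (trans (sym (m+n∸m≡n X d)) (cong (_∸ X) (sym Y≡X+d)))
        (inj₂ (_ , Y≡X))   → <⇒≢ x<y (sym Y≡X)

sameEdge-comm : ∀ {n} e (x y : Fin n) → sameEdge e x y ≡ sameEdge e y x
sameEdge-comm (i , j) x y = trans (∨-comm ((X ≡ᵇ i) ∧ (Y ≡ᵇ j)) ((X ≡ᵇ j) ∧ (Y ≡ᵇ i)))
                                   (cong₂ _∨_ (∧-comm (X ≡ᵇ j) (Y ≡ᵇ i)) (∧-comm (X ≡ᵇ i) (Y ≡ᵇ j)))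
  where
  X Y : ℕ
  X = toℕ x
  Y = toℕ y

∑E-edge : ∀ {n} {M : Partner n} → IsNCPM n M → (w : ℕ → ℕ → ℕ) → (∀ i j → w i j ≡ w j i) →
          ∀ {x y} → M x ≡ y → ∑E n (λ i j → w i j * ind (sameEdge (i , j) x y)) ≡ w (toℕ x) (toℕ y)
∑E-edge {n} {M} N w w-sym {x} refl with <-cmp (toℕ x) (toℕ (M x))
... | tri< x<y _ _ = ∑E-sameEdge x (M x) w x<y (NCPM.edge-odd N x x<y)
... | tri≈ _ x≡y _ = contradiction x≡y (NCPM.toℕ-partner-≢ N refl)
... | tri> _ _ y<x = begin
  ∑E n (λ i j → w i j * ind (sameEdge (i , j) x (M x)))
    ≡⟨ ∑E-cong-≗ n (λ i j → cong (λ b → w i j * ind b) (sameEdge-comm (i , j) x (M x))) ⟩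
  ∑E n (λ i j → w i j * ind (sameEdge (i , j) (M x) x))
    ≡⟨ ∑E-sameEdge (M x) x w y<x odd ⟩
  w (toℕ (M x)) (toℕ x)
    ≡⟨ w-sym _ _ ⟩
  w (toℕ x) (toℕ (M x)) ∎
  where
  open ≡-Reasoning
  odd : (toℕ x ∸ toℕ (M x)) % 2 ≡ 1
  odd = subst (λ z → (toℕ z ∸ toℕ (M x)) % 2 ≡ 1) (NCPM.involutive N x)
              (NCPM.edge-odd N (M x) (subst (λ z → toℕ (M x) < toℕ z) (sym (NCPM.involutive N x)) y<x))

-- The total length of E_m

-- G₄ and G₁ are the weights, by distance d, of the two sums compared in length-balance.
module _ (m : ℕ) (m-even : m % 2 ≡ 0) where
  private
    G₄ G₁ : ℕ → ℕ
    G₄ d = d % 2 * (4 * span (2 * m) d)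
    G₁ d = d % 2 * (m ∸ 2)

    pair-balance : ∀ d → d ≤ m → G₄ d + G₄ (m ∸ d) ≡ G₁ d + G₁ (m ∸ d)
    pair-balance d d≤m rewrite %2-complement d m-even d≤m with %2-cases d
    ... | inj₁ even rewrite even = refl
    ... | inj₂ odd  rewrite odd  = begin
      1 * (4 * span (2 * m) d) + 1 * (4 * span (2 * m) (m ∸ d))
        ≡⟨ cong₂ (λ x y → 1 * (4 * x) + 1 * (4 * y)) (span-odd _ d odd (doubled d≤m))
                                                     (span-odd _ (m ∸ d) odd′ (doubled (m∸n≤m m d))) ⟩
      1 * (4 * a) + 1 * (4 * b)
        ≡⟨ regroup a b ⟩
      1 * (a * 2 + b * 2) + 1 * (a * 2 + b * 2)
        ≡⟨ cong (λ x → 1 * x + 1 * x) m∸2≡ ⟨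
      1 * (m ∸ 2) + 1 * (m ∸ 2) ∎
      where
      open ≡-Reasoning
      a b : ℕ
      a = d / 2
      b = (m ∸ d) / 2
      odd′ : (m ∸ d) % 2 ≡ 1
      odd′ = trans (%2-complement d m-even d≤m) odd
      doubled : ∀ {x} → x ≤ m → x + x ≤ 2 * m
      doubled {x} x≤m = subst (x + x ≤_) (sym (2*m≡m+m m)) (+-mono-≤ x≤m x≤m)
      regroup : ∀ a b → 1 * (4 * a) + 1 * (4 * b) ≡ 1 * (a * 2 + b * 2) + 1 * (a * 2 + b * 2)
      regroup = solve-∀
      m∸2≡ : m ∸ 2 ≡ a * 2 + b * 2
      m∸2≡ = cong (_∸ 2) (begin
        m                                ≡⟨ m+[n∸m]≡n d≤m ⟨
        d + (m ∸ d)                      ≡⟨ cong₂ _+_ (odd-split d odd) (odd-split (m ∸ d) odd′) ⟩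
        suc (a * 2) + suc (b * 2)        ≡⟨ cong suc (+-suc (a * 2) (b * 2)) ⟩
        2 + (a * 2 + b * 2)              ∎)

    2m-even : (2 * m) % 2 ≡ 0
    2m-even = trans (cong (_% 2) (*-comm 2 m)) (m*n%n≡0 m 2)

    G₄-symmetric : SymmetricOn (2 * m) G₄
    G₄-symmetric d d≤2m = cong₂ (λ p s → p * (4 * s)) (%2-complement d 2m-even d≤2m) (span-complement _ d d≤2m)

    G₁-symmetric : SymmetricOn (2 * m) G₁
    G₁-symmetric d d≤2m = cong (_* (m ∸ 2)) (%2-complement d 2m-even d≤2m)

    ∑G₄≡∑G₁ : ∑[ d < suc (2 * m) ] G₄ d ≡ ∑[ d < suc (2 * m) ] G₁ d
    ∑G₄≡∑G₁ = begin
      ∑[ d < suc (2 * m) ] G₄ d                      ≡⟨ ∑-halves m G₄-symmetric (cong (_* (4 * span (2 * m) m)) m-even) ⟩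
      ∑[ d < suc m ] G₄ d + ∑[ d < suc m ] G₄ d      ≡⟨ cong₂ _+_ half half ⟩
      ∑[ d < suc m ] G₁ d + ∑[ d < suc m ] G₁ d      ≡⟨ ∑-halves m G₁-symmetric (cong (_* (m ∸ 2)) m-even) ⟨
      ∑[ d < suc (2 * m) ] G₁ d                      ∎
      where
      open ≡-Reasoning
      half : ∑[ d < suc m ] G₄ d ≡ ∑[ d < suc m ] G₁ d
      half = ∑-pairing m pair-balance

  length-balance : ∑E (2 * m) (λ i j → 4 * span (2 * m) ∣ i - j ∣) ≡ ∑E (2 * m) (λ _ _ → m ∸ 2)
  length-balance = begin
    ∑E (2 * m) (λ i j → 4 * span (2 * m) ∣ i - j ∣) ≡⟨ ∑E-distance (2 * m) (λ d → 4 * span (2 * m) d) ⟩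
    triangleSum (2 * m) G₄                         ≡⟨ double-injective _ _ (begin
      triangleSum (2 * m) G₄ + triangleSum (2 * m) G₄ ≡⟨ triangle-symmetric G₄-symmetric ⟩
      2 * m * ∑[ d < suc (2 * m) ] G₄ d               ≡⟨ cong (2 * m *_) ∑G₄≡∑G₁ ⟩
      2 * m * ∑[ d < suc (2 * m) ] G₁ d               ≡⟨ triangle-symmetric G₁-symmetric ⟨
      triangleSum (2 * m) G₁ + triangleSum (2 * m) G₁ ∎) ⟩
    triangleSum (2 * m) G₁                         ≡⟨ ∑E-distance (2 * m) (λ _ → m ∸ 2) ⟨
    ∑E (2 * m) (λ _ _ → m ∸ 2)                     ∎
    where open ≡-Reasoning

-- Rainbow cycles

module _ {m r k} {Ms : ℕ → Partner (2 * m)} {F : ℕ → Quad (2 * m)} (RC : RainbowCycle m r k Ms F) where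
  open RainbowCycle RC

  vertex-suc : ∀ t → t < k → IsNCPM (2 * m) (Ms (suc t))
  vertex-suc t t<k with m≤n⇒m<n∨m≡n t<k
  ... | inj₁ 1+t<k = vertices (suc t) 1+t<k
  ... | inj₂ refl  = ncpm-cong (λ x → sym (closed x)) (vertices 0 (≤-<-trans z≤n t<k))

  added≡removed : ∑[ t < k ] addedLength (F t) ≡ ∑[ t < k ] removedLength (F t)
  added≡removed = *-cancelˡ-≡ _ _ 2 (+-cancelˡ-≡ (potential (Ms 0)) _ _ (begin
    potential (Ms 0) + 2 * ∑[ t < k ] addedLength (F t)   ≡⟨ cong (potential (Ms 0) +_) (∑-*ˡ 2 _ k) ⟨
    potential (Ms 0) + ∑[ t < k ] (2 * addedLength (F t)) ≡⟨ telescope (potential ∘ Ms) _ _ k step ⟩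
    potential (Ms k) + ∑[ t < k ] (2 * removedLength (F t)) ≡⟨ cong₂ _+_ potential-closed (∑-*ˡ 2 _ k) ⟩
    potential (Ms 0) + 2 * ∑[ t < k ] removedLength (F t) ∎))
    where
    open ≡-Reasoning
    step : ∀ t → t < k → potential (Ms t) + 2 * addedLength (F t) ≡ potential (Ms (suc t)) + 2 * removedLength (F t)
    step t t<k = potential-flip (vertices t t<k) (vertex-suc t t<k) (arcs t t<k)
    potential-closed : potential (Ms k) ≡ potential (Ms 0)
    potential-closed = sum-cong-≗ λ x → cong (edgeLength x) (closed x)

  module _ (w : ℕ → ℕ → ℕ) (w-sym : ∀ i j → w i j ≡ w j i) where

    labelWeight : ℕ → ℕ
    labelWeight t = w (toℕ (qa (F t))) (toℕ (qc (F t))) + w (toℕ (qb (F t))) (toℕ (qd (F t)))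

    weightedCount : ℕ → ℕ
    weightedCount t = ∑E (2 * m) λ i j → w i j * labelCount F (i , j) t

    weightedCount-labels : ∀ t → t ≤ k → weightedCount t ≡ ∑[ s < t ] labelWeight s
    weightedCount-labels zero    _   = ∑E-zero (2 * m) λ i j → *-zeroʳ (w i j)
    weightedCount-labels (suc t) 1+t≤k = begin
      weightedCount (suc t)
        ≡⟨ ∑E-cong-≗ (2 * m) (λ i j → distrib (w i j) _ _ _) ⟩
      ∑E (2 * m) (λ i j → w i j * labelCount F (i , j) t + w i j * ind (sameEdge (i , j) a c)
                                                       + w i j * ind (sameEdge (i , j) b d))
        ≡⟨ ∑E-+ (2 * m) _ _ ⟩
      ∑E (2 * m) (λ i j → w i j * labelCount F (i , j) t + w i j * ind (sameEdge (i , j) a c))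
        + ∑E (2 * m) (λ i j → w i j * ind (sameEdge (i , j) b d))
        ≡⟨ cong (_+ ∑E (2 * m) (λ i j → w i j * ind (sameEdge (i , j) b d))) (∑E-+ (2 * m) _ _) ⟩
      weightedCount t + ∑E (2 * m) (λ i j → w i j * ind (sameEdge (i , j) a c))
        + ∑E (2 * m) (λ i j → w i j * ind (sameEdge (i , j) b d))
        ≡⟨ cong₂ _+_ (cong₂ _+_ (weightedCount-labels t (<⇒≤ 1+t≤k)) (∑E-edge N' w w-sym ac∈M'))
                     (∑E-edge N' w w-sym bd∈M') ⟩
      ∑[ s < t ] labelWeight s + w (toℕ a) (toℕ c) + w (toℕ b) (toℕ d)
        ≡⟨ +-assoc (∑[ s < t ] labelWeight s) _ _ ⟩
      ∑[ s < suc t ] labelWeight s ∎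
      where
      open ≡-Reasoning
      open IsFlip (arcs t 1+t≤k)
      a b c d : Fin (2 * m)
      a = qa (F t)
      b = qb (F t)
      c = qc (F t)
      d = qd (F t)
      N' : IsNCPM (2 * m) (Ms (suc t))
      N' = vertex-suc t 1+t≤k
      distrib : ∀ x y z u → x * (y + z + u) ≡ x * y + x * z + x * u
      distrib = solve-∀

    rainbow-weight : ∑[ t < k ] labelWeight t ≡ r * ∑E (2 * m) w
    rainbow-weight = begin
      ∑[ t < k ] labelWeight t                         ≡⟨ weightedCount-labels k ≤-refl ⟨
      weightedCount k                                  ≡⟨ ∑E-cong (2 * m) counted ⟩
      ∑E (2 * m) (λ i j → r * w i j)                   ≡⟨ ∑E-*ˡ (2 * m) r w ⟩
      r * ∑E (2 * m) w                                 ∎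
      where
      open ≡-Reasoning
      counted : ∀ i d → i + d < 2 * m → d % 2 ≡ 1 → w i (i + d) * labelCount F (i , i + d) k ≡ r * w i (i + d)
      counted i d i+d<n odd = trans (cong (w i (i + d) *_) (rainbow (i , i + d) inE)) (*-comm (w i (i + d)) r)
        where
        0<d : 0 < d
        0<d = odd⇒0< d odd
        inE : InE (2 * m) (i , i + d)
        inE = m<m+n i 0<d , i+d<n , subst (λ e → e % 2 ≡ 1) (sym (m+n∸m≡n i d)) odd

  added-total : m % 2 ≡ 0 → ∑[ t < k ] addedLength (F t) + ∑[ t < k ] addedLength (F t) ≡ ∑[ t < k ] (m ∸ 2)
  added-total m-even = *-cancelˡ-≡ _ _ 2 (begin
    2 * (A + A)                                         ≡⟨ 2[x+x]≡4x A ⟩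
    4 * A                                               ≡⟨ ∑-*ˡ 4 _ k ⟨
    ∑[ t < k ] (4 * addedLength (F t))                  ≡⟨ ∑-cong k (λ t _ → *-distribˡ-+ 4 (ac t) (bd t)) ⟩
    ∑[ t < k ] labelWeight w₄ w₄-sym t                  ≡⟨ rainbow-weight w₄ w₄-sym ⟩
    r * ∑E (2 * m) w₄                                   ≡⟨ cong (r *_) (length-balance m m-even) ⟩
    r * ∑E (2 * m) (λ _ _ → m ∸ 2)                       ≡⟨ rainbow-weight (λ _ _ → m ∸ 2) (λ _ _ → refl) ⟨
    ∑[ t < k ] (m ∸ 2 + (m ∸ 2))                         ≡⟨ ∑-+ k ⟩
    ∑[ t < k ] (m ∸ 2) + ∑[ t < k ] (m ∸ 2)              ≡⟨ cong (∑[ t < k ] (m ∸ 2) +_) (+-identityʳ _) ⟨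
    2 * ∑[ t < k ] (m ∸ 2)                              ∎)
    where
    open ≡-Reasoning
    A : ℕ
    A = ∑[ t < k ] addedLength (F t)
    ac bd : ℕ → ℕ
    ac t = edgeLength (qa (F t)) (qc (F t))
    bd t = edgeLength (qb (F t)) (qd (F t))
    w₄ : ℕ → ℕ → ℕ
    w₄ i j = 4 * span (2 * m) ∣ i - j ∣
    w₄-sym : ∀ i j → w₄ i j ≡ w₄ j i
    w₄-sym i j = cong (λ d → 4 * span (2 * m) d) (∣-∣-comm i j)
    2[x+x]≡4x : ∀ x → 2 * (x + x) ≡ 4 * x
    2[x+x]≡4x = solve-∀

  flipLength-total : m % 2 ≡ 0 → ∑[ t < k ] flipLength (F t) ≡ ∑[ t < k ] (m ∸ 2)
  flipLength-total m-even = begin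
    ∑[ t < k ] flipLength (F t)                                     ≡⟨ ∑-cong k (λ t _ → flipLength-split (F t)) ⟩
    ∑[ t < k ] (removedLength (F t) + addedLength (F t))            ≡⟨ ∑-+ k ⟩
    ∑[ t < k ] removedLength (F t) + ∑[ t < k ] addedLength (F t)   ≡⟨ cong (_+ ∑[ t < k ] addedLength (F t)) added≡removed ⟨
    ∑[ t < k ] addedLength (F t) + ∑[ t < k ] addedLength (F t)     ≡⟨ added-total m-even ⟩
    ∑[ t < k ] (m ∸ 2)                                              ∎
    where open ≡-Reasoning

lemma10 : (m r : ℕ) → m % 2 ≡ 0 → 2 ≤ m → 1 ≤ r →
          (k : ℕ) (Ms : ℕ → Partner (2 * m)) (F : ℕ → Quad (2 * m)) →
          RainbowCycle m r k Ms F →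
          ∀ t → t < k → Centered m (F t)
lemma10 m r m-even _ _ k Ms F RC =
  ∑-mono-≤-equality k (λ t t<k → flipLength-bound m (vertices t t<k) (vertex-suc RC t t<k) (arcs t t<k))
                      (flipLength-total RC m-even)
  where open RainbowCycle RC
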